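{- Let $q=p^m$ be a power of a prime $p$, let $G\in\mathbb{F}_q[x]$, and let $n,r$ be positive integers such that $d:=(m,r)=(mn,r)$, $p\nmid n$ and $(n,p^{(m,r)}-1)=1$. Then \[f(x)=ax^{p^r}+x\left(G(T_{q^n|q}(x))-aT_{q^n|q}(x)^{p^r-1}\right)\] is a complete permutation polynomial over $\mathbb{F}_{q^n}$ for each $a\in\mathbb{F}_q^*$ if and only if $xG(x)$ is a complete permutation polynomial over $\mathbb{F}_q$.
   Context: $T_{q^n|q}(x)=\sum_{i=0}^{n-1}x^{q^i}$ is the trace from $\mathbb{F}_{q^n}$ to $\mathbb{F}_q$. A polynomial $h$ is a complete permutation polynomial (complete mapping) over a finite field $K$ if both $h(x)$ and $h(x)+x$ induce permutations of $K$. -}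

module Defs where

open import Level using (Level; _⊔_; suc)
open import Data.Nat as ℕ using (ℕ; zero; suc)
open import Data.Fin using (Fin)
open import Data.List using (List; []; _∷_)
open import Data.List.Relation.Unary.All using (All)
open import Data.Product using (Σ; _×_; ∃)
open import Relation.Nullary using (¬_)
open import Relation.Binary.PropositionalEquality as ≡ using (_≡_)
open import Function.Bundles using (Bijection)
open import Algebra.Bundles using (CommutativeRing; Semiring)
open import Data.Unit.Polymorphic using (⊤)
import Algebra.Definitions.RawSemiring as RS

record Field (c ℓ : Level) : Set (Level.suc (c ⊔ ℓ)) where
  field
    commutativeRing : CommutativeRing c ℓ
  open CommutativeRing commutativeRing public
  field
    0≉1     : ¬ (0# ≈ 1#)
    inverse : ∀ x → ¬ (x ≈ 0#) → ∃ λ y → x * y ≈ 1#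
  open RS (Semiring.rawSemiring semiring) public using (_^_)

HasSize : ∀ {c ℓ} → Field c ℓ → ℕ → Set (c ⊔ ℓ)
HasSize K N = Bijection (≡.setoid (Fin N)) (Field.setoid K)

module _ {c ℓ} (K : Field c ℓ) where
  open Field K

  sumTo : ℕ → (ℕ → Carrier) → Carrier
  sumTo zero    f = 0#
  sumTo (suc n) f = sumTo n f + f n

  trace : (q n : ℕ) → Carrier → Carrier
  trace q n x = sumTo n (λ i → x ^ (q ℕ.^ i))

  -- The subfield F_q of K: elements fixed by x ↦ x^q.
  InSub : ℕ → Carrier → Set ℓ
  InSub q x = x ^ q ≈ x

  -- Polynomials as coefficient lists (constant term first), evaluated by Horner.
  evalPoly : List Carrier → Carrier → Carrier
  evalPoly []       x = 0#
  evalPoly (c ∷ cs) x = c + x * evalPoly cs x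

  PolyOver : ℕ → List Carrier → Set (c ⊔ ℓ)
  PolyOver q G = All (InSub q) G

  PermutesOn : (Carrier → Set ℓ) → (Carrier → Carrier) → Set (c ⊔ ℓ)
  PermutesOn S h =
    (∀ x → S x → S (h x)) ×
    (∀ x y → S x → S y → h x ≈ h y → x ≈ y) ×
    (∀ y → S y → Σ Carrier λ x → S x × h x ≈ y)

  CompletePermOn : (Carrier → Set ℓ) → (Carrier → Carrier) → Set (c ⊔ ℓ)
  CompletePermOn S h = PermutesOn S h × PermutesOn S (λ x → h x + x)

  Whole : Carrier → Set ℓ
  Whole _ = ⊤

{-# OPTIONS --safe #-}
module Submission where

-- Write T for the trace, P = p^r and L c x = a x^P + x c. Then f x = L c x with
-- c = G(T x) − a (T x)^(P−1) ∈ F_q, and T ∘ f = h ∘ T for h s = s G(s), because T is F_q-linear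
-- and commutes with x ↦ x^P. Since T maps onto F_q (n ≠ 0 in F_q as p ∤ n), f permutes F_{q^n}
-- iff h permutes F_q, provided L c has no nonzero root z of trace 0. For such a root,
-- u = z^(q−1) satisfies u^P = u and u^(p^(mn)) = u, hence u ∈ F_{p^d} ⊆ F_q with d = (m, r);
-- then u^n = z^(q^n−1) = 1 and u^(p^d−1) = 1 give u = 1, since (n, p^d−1) = 1. So z ∈ F_q and
-- T z = n z ≠ 0. Replacing G by G + 1 turns f and h into f + x and h + x, which gives completeness.

open import Defs
open import Level using (_⊔_)
open import Data.Nat.Base as ℕ using (ℕ; zero; suc)
import Data.Nat.Properties as ℕ
open import Data.Nat.Divisibility using (_∣_)
open import Data.Nat.GCD using (gcd; gcd[m,n]∣m)
open import Data.Nat.Primality using (Prime; prime⇒nonZero)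
open import Data.Fin.Base using (Fin)
open import Data.Product using (Σ; ∃; _,_; proj₁; proj₂)
open import Function.Bundles using (Bijection; _⇔_; mk⇔)
open import Relation.Binary.Bundles using (Setoid)
open import Relation.Nullary using (¬_; Dec; yes; no; contradiction)
open import Relation.Binary.PropositionalEquality as ≡ using (_≡_; _≢_)

module _ where
  open import Data.Nat
  open import Data.Nat.Properties
  open import Data.Nat.Divisibility
  open import Data.Nat.DivMod using (m/n*n≡m)
  open import Data.Nat.GCD
  open import Data.Nat.Primality
  open import Data.Nat.Combinatorics using (_C_; k![n∸k]!∣n!)
  open import Data.Nat.Combinatorics.Specification using (nCk≡n!/k![n-k]!)
  open import Data.Fin using (Fin; punchOut)
  open import Data.Fin.Properties using (any?; injective⇒≤; punchOut-injective) renaming (_≟_ to _≟ᶠ_)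
  open import Data.Sum using (inj₁; inj₂)
  open import Function.Definitions using (Injective)
  open Bézout.Identity using (+-; -+)

  prime∤! : ∀ {p k} → Prime p → k < p → ¬ p ∣ k !
  prime∤! {k = zero}  pp _   p∣1 = ¬prime[1] (≡.subst Prime (∣1⇒≡1 p∣1) pp)
  prime∤! {k = suc k} pp k<p p∣k! with euclidsLemma (suc k) (k !) pp p∣k!
  ... | inj₁ p∣1+k = >⇒∤ k<p p∣1+k
  ... | inj₂ p∣k!  = prime∤! pp (<-trans (n<1+n k) k<p) p∣k!

  n∣n! : ∀ n .{{_ : NonZero n}} → n ∣ n !
  n∣n! (suc n) = m∣m*n (n !)

  n!≡nCk*k![n∸k]! : ∀ {n k} → k ≤ n → n ! ≡ (n C k) * (k ! * (n ∸ k) !)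
  n!≡nCk*k![n∸k]! {n} {k} k≤n = ≡.trans (≡.sym (m/n*n≡m (k![n∸k]!∣n! k≤n)))
    (≡.cong (_* (k ! * (n ∸ k) !)) (≡.sym (nCk≡n!/k![n-k]! k≤n)))
    where instance _ = k !* (n ∸ k) !≢0

  prime∣binomial : ∀ {p k} → Prime p → 0 < k → k < p → p ∣ p C k
  prime∣binomial {p} {k} pp 0<k k<p
    with euclidsLemma (p C k) (k ! * (p ∸ k) !) pp
           (≡.subst (p ∣_) (n!≡nCk*k![n∸k]! (<⇒≤ k<p)) (n∣n! p {{prime⇒nonZero pp}}))
  ... | inj₁ p∣coefficient = p∣coefficient
  ... | inj₂ p∣k![p-k]! with euclidsLemma (k !) ((p ∸ k) !) pp p∣k![p-k]!
  ...   | inj₁ p∣k!     = contradiction p∣k! (prime∤! pp k<p)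
  ...   | inj₂ p∣[p-k]! = contradiction p∣[p-k]! (prime∤! pp (∸-monoʳ-< 0<k (<⇒≤ k<p)))

  prime∤⇒gcd≡1 : ∀ {p n} → Prime p → ¬ p ∣ n → gcd n p ≡ 1
  prime∤⇒gcd≡1 {p} {n} pp p∤n with prime⇒irreducible pp (gcd[m,n]∣n n p)
  ... | inj₁ gcd≡1 = gcd≡1
  ... | inj₂ gcd≡p = contradiction (≡.subst (_∣ n) gcd≡p (gcd[m,n]∣m n p)) p∤n

  record IsSubtractiveIdeal {ℓ} (P : ℕ → Set ℓ) : Set ℓ where
    field
      0-closed : P 0
      +-closed : ∀ {a b} → P a → P b → P (a + b)
      ∸-closed : ∀ {a b} → P a → P (a + b) → P b

    *-closed : ∀ k {a} → P a → P (k * a)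
    *-closed zero    _  = 0-closed
    *-closed (suc k) Pa = +-closed Pa (*-closed k Pa)

    ∣-closed : ∀ {a b} → a ∣ b → P a → P b
    ∣-closed (divides k ≡.refl) Pa = *-closed k Pa

    gcd-closed : ∀ a b → P a → P b → P (gcd a b)
    gcd-closed a b Pa Pb with Bézout.identity (gcd-GCD a b)
    ... | +- x y d+yb≡xa =
      ∸-closed (*-closed y Pb) (≡.subst P (≡.trans (≡.sym d+yb≡xa) (+-comm (gcd a b) _)) (*-closed x Pa))
    ... | -+ x y d+xa≡yb =
      ∸-closed (*-closed x Pa) (≡.subst P (≡.trans (≡.sym d+xa≡yb) (+-comm (gcd a b) _)) (*-closed y Pb))

  Fin-inhabited⇒≡suc : ∀ {n} → Fin n → ∃ λ m → n ≡ suc m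
  Fin-inhabited⇒≡suc {suc m} _ = m , ≡.refl

  Fin-injective⇒surjective : ∀ {n} (f : Fin n → Fin n) → Injective _≡_ _≡_ f →
                             ∀ y → ∃ λ x → f x ≡ y
  Fin-injective⇒surjective {suc n} f inj y with any? (λ x → f x ≟ᶠ y)
  ... | yes hit = hit
  ... | no miss = contradiction (injective⇒≤ avoid-y-injective) 1+n≰n
    where
    y≢f : ∀ x → y ≢ f x
    y≢f x y≡fx = miss (x , ≡.sym y≡fx)
    avoid-y : Fin (suc n) → Fin n
    avoid-y x = punchOut (y≢f x)
    avoid-y-injective : Injective _≡_ _≡_ avoid-y
    avoid-y-injective eq = inj (punchOut-injective (y≢f _) (y≢f _) eq)

  Fin-surjective⇒injective : ∀ {n} (f : Fin n → Fin n) → (∀ y → ∃ λ x → f x ≡ y) →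
                             Injective _≡_ _≡_ f
  Fin-surjective⇒injective f f-surjective {x} {y} fx≡fy =
    ≡.trans (x≡s[fx] x) (≡.trans (≡.cong s fx≡fy) (≡.sym (x≡s[fx] y)))
    where
    s : Fin _ → Fin _
    s y = proj₁ (f-surjective y)
    f∘s≗id : ∀ y → f (s y) ≡ y
    f∘s≗id y = proj₂ (f-surjective y)
    s-injective : Injective _≡_ _≡_ s
    s-injective {y} {y′} eq = ≡.trans (≡.sym (f∘s≗id y)) (≡.trans (≡.cong f eq) (f∘s≗id y′))
    x≡s[fx] : ∀ x → x ≡ s (f x)
    x≡s[fx] x with x′ , sx′≡x ← Fin-injective⇒surjective s s-injective x =
      ≡.trans (≡.sym sx′≡x) (≡.cong s (≡.trans (≡.sym (f∘s≗id x′)) (≡.cong f sx′≡x)))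

module FieldProperties {c ℓ} (K : Field c ℓ) where
  open import Data.Nat.Combinatorics using (_C_; nCn≡1)
  open import Data.Fin as Fin using (Fin; zero; suc; toℕ; fromℕ; inject₁)
  import Data.Fin.Properties as Fin
  open import Data.List using ([]; _∷_)
  open import Data.List.Relation.Unary.All using (All; []; _∷_)
  open Field K hiding (zero)
  open import Algebra.Properties.Ring ring public using (+-cancelʳ; x+x≈x⇒x≈0; +-inverseˡ-unique)
  open import Algebra.Properties.Semiring.Exp semiring public
    using (^-congˡ; ^-congʳ; ^-homo-*; ^-assocʳ)
  open import Algebra.Properties.CommutativeSemiring.Exp commutativeSemiring public using (^-distrib-*)
  open import Algebra.Properties.Semiring.Mult semiring public
    using (_×_; ×-congʳ; ×-homo-+; ×-assoc-*; ×1-homo-*)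
  import Algebra.Properties.Semiring.Sum semiring as Sum
  import Algebra.Properties.CommutativeMonoid.Sum *-commutativeMonoid as Product
  import Algebra.Properties.CommutativeSemiring.Binomial commutativeSemiring as Binomial
  open import Relation.Binary.Reasoning.Setoid setoid

  x*y≉0 : ∀ {x y} → x ≉ 0# → y ≉ 0# → x * y ≉ 0#
  x*y≉0 {x} {y} x≉0 y≉0 xy≈0 = 0≉1 (begin
    0#                  ≈⟨ zeroˡ (x⁻¹ * y⁻¹) ⟨
    0# * (x⁻¹ * y⁻¹)    ≈⟨ *-congʳ xy≈0 ⟨
    x * y * (x⁻¹ * y⁻¹) ≈⟨ interchange x y x⁻¹ y⁻¹ ⟩
    x * x⁻¹ * (y * y⁻¹) ≈⟨ *-cong (proj₂ (inverse x x≉0)) (proj₂ (inverse y y≉0)) ⟩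
    1# * 1#             ≈⟨ *-identityˡ 1# ⟩
    1#                  ∎)
    where
    open import Algebra.Properties.CommutativeSemigroup *-commutativeSemigroup using (interchange)
    x⁻¹ = proj₁ (inverse x x≉0)
    y⁻¹ = proj₁ (inverse y y≉0)

  x^n≉0 : ∀ {x} → x ≉ 0# → ∀ n → x ^ n ≉ 0#
  x^n≉0 x≉0 zero    1≈0 = 0≉1 (sym 1≈0)
  x^n≉0 x≉0 (suc n)     = x*y≉0 x≉0 (x^n≉0 x≉0 n)

  *-cancelʳ-≉0 : ∀ {x y z} → z ≉ 0# → x * z ≈ y * z → x ≈ y
  *-cancelʳ-≉0 {x} {y} {z} z≉0 xz≈yz = begin
    x                ≈⟨ *-identityʳ x ⟨
    x * 1#           ≈⟨ *-congˡ z*z⁻¹≈1 ⟨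
    x * (z * z⁻¹)    ≈⟨ *-assoc x z z⁻¹ ⟨
    x * z * z⁻¹      ≈⟨ *-congʳ xz≈yz ⟩
    y * z * z⁻¹      ≈⟨ *-assoc y z z⁻¹ ⟩
    y * (z * z⁻¹)    ≈⟨ *-congˡ z*z⁻¹≈1 ⟩
    y * 1#           ≈⟨ *-identityʳ y ⟩
    y                ∎
    where
    z⁻¹ = proj₁ (inverse z z≉0)
    z*z⁻¹≈1 = proj₂ (inverse z z≉0)

  *-cancelˡ-≉0 : ∀ {x y z} → z ≉ 0# → z * x ≈ z * y → x ≈ y
  *-cancelˡ-≉0 {x} {y} {z} z≉0 zx≈zy = *-cancelʳ-≉0 z≉0 (trans (*-comm x z) (trans zx≈zy (*-comm z y)))

  1^n≈1 : ∀ n → 1# ^ n ≈ 1#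
  1^n≈1 zero    = refl
  1^n≈1 (suc n) = trans (*-identityˡ _) (1^n≈1 n)

  product≉0 : ∀ {n} (f : Fin n → Carrier) → (∀ i → f i ≉ 0#) → Product.sum f ≉ 0#
  product≉0 {zero}  f f≉0 1≈0 = 0≉1 (sym 1≈0)
  product≉0 {suc n} f f≉0     = x*y≉0 (f≉0 zero) (product≉0 (λ i → f (suc i)) (λ i → f≉0 (suc i)))

  ×1-homo-^ : ∀ b k → (b ℕ.^ k) × 1# ≈ (b × 1#) ^ k
  ×1-homo-^ b zero    = +-identityʳ 1#
  ×1-homo-^ b (suc k) = trans (×1-homo-* b (b ℕ.^ k)) (*-congˡ (×1-homo-^ b k))

  ×1≈0⇒×≈0 : ∀ k → k × 1# ≈ 0# → ∀ x → k × x ≈ 0#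
  ×1≈0⇒×≈0 k k≈0 x = begin
    k × x          ≈⟨ ×-congʳ k (*-identityˡ x) ⟨
    k × (1# * x)   ≈⟨ ×-assoc-* k 1# x ⟨
    (k × 1#) * x   ≈⟨ *-congʳ k≈0 ⟩
    0# * x         ≈⟨ zeroˡ x ⟩
    0#             ∎

  sumTo-cong : ∀ n {f g : ℕ → Carrier} → (∀ i → f i ≈ g i) → sumTo K n f ≈ sumTo K n g
  sumTo-cong zero    f≈g = refl
  sumTo-cong (suc n) f≈g = +-cong (sumTo-cong n f≈g) (f≈g n)

  sumTo-distrib-+ : ∀ n (f g : ℕ → Carrier) → sumTo K n (λ i → f i + g i) ≈ sumTo K n f + sumTo K n g
  sumTo-distrib-+ zero    f g = sym (+-identityʳ 0#)
  sumTo-distrib-+ (suc n) f g = trans (+-congʳ (sumTo-distrib-+ n f g)) (interchange _ _ _ _)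
    where open import Algebra.Properties.CommutativeSemigroup +-commutativeSemigroup using (interchange)

  sumTo-distribʳ-* : ∀ n (f : ℕ → Carrier) x → sumTo K n f * x ≈ sumTo K n (λ i → f i * x)
  sumTo-distribʳ-* zero    f x = zeroˡ x
  sumTo-distribʳ-* (suc n) f x = trans (distribʳ x _ _) (+-congʳ (sumTo-distribʳ-* n f x))

  sumTo-const : ∀ n x → sumTo K n (λ _ → x) ≈ (n × 1#) * x
  sumTo-const zero    x = sym (zeroˡ x)
  sumTo-const (suc n) x = begin
    sumTo K n (λ _ → x) + x   ≈⟨ +-cong (sumTo-const n x) (sym (*-identityˡ x)) ⟩
    (n × 1#) * x + 1# * x     ≈⟨ +-comm _ _ ⟩
    1# * x + (n × 1#) * x     ≈⟨ distribʳ x 1# (n × 1#) ⟨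
    (suc n × 1#) * x          ∎

  sumTo-rotate : ∀ n (f : ℕ → Carrier) → sumTo K n (λ i → f (suc i)) + f 0 ≈ sumTo K n f + f n
  sumTo-rotate zero    f = refl
  sumTo-rotate (suc n) f = begin
    sumTo K n (λ i → f (suc i)) + f (suc n) + f 0   ≈⟨ xy∙z≈xz∙y _ _ _ ⟩
    sumTo K n (λ i → f (suc i)) + f 0 + f (suc n)   ≈⟨ +-congʳ (sumTo-rotate n f) ⟩
    sumTo K n f + f n + f (suc n)                   ∎
    where open import Algebra.Properties.CommutativeSemigroup +-commutativeSemigroup using (xy∙z≈xz∙y)

  evalPoly-cong : ∀ G {x y} → x ≈ y → evalPoly K G x ≈ evalPoly K G y
  evalPoly-cong []      x≈y = refl
  evalPoly-cong (g ∷ G) x≈y = +-congˡ (*-cong x≈y (evalPoly-cong G x≈y))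

  PermutesOn-cong : ∀ {S : Carrier → Set ℓ} → (∀ {x y} → x ≈ y → S x → S y) →
                    ∀ {f g} → (∀ x → f x ≈ g x) → PermutesOn K S f ⇔ PermutesOn K S g
  PermutesOn-cong {S} S-resp f≈g = mk⇔ (transport f≈g) (transport (λ x → sym (f≈g x)))
    where
    transport : ∀ {f g} → (∀ x → f x ≈ g x) → PermutesOn K S f → PermutesOn K S g
    transport f≈g (maps-into , injective , onto) =
      (λ x Sx → S-resp (f≈g x) (maps-into x Sx)) ,
      (λ x y Sx Sy gx≈gy → injective x y Sx Sy (trans (f≈g x) (trans gx≈gy (sym (f≈g y))))) ,
      (λ y Sy → let x , Sx , fx≈y = onto y Sy in x , Sx , trans (sym (f≈g x)) fx≈y)

  ×1≈0-isSubtractiveIdeal : IsSubtractiveIdeal (λ k → k × 1# ≈ 0#)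
  ×1≈0-isSubtractiveIdeal = record
    { 0-closed = refl
    ; +-closed = λ {a} {b} a≈0 b≈0 → trans (×-homo-+ 1# a b) (trans (+-cong a≈0 b≈0) (+-identityʳ 0#))
    ; ∸-closed = λ {a} {b} a≈0 a+b≈0 → begin
        b × 1#            ≈⟨ +-identityˡ (b × 1#) ⟨
        0# + b × 1#       ≈⟨ +-congʳ a≈0 ⟨
        a × 1# + b × 1#   ≈⟨ ×-homo-+ 1# a b ⟨
        (a ℕ.+ b) × 1#    ≈⟨ a+b≈0 ⟩
        0#                ∎
    }

  ^≈1-isSubtractiveIdeal : ∀ x → IsSubtractiveIdeal (λ k → x ^ k ≈ 1#)
  ^≈1-isSubtractiveIdeal x = record
    { 0-closed = refl
    ; +-closed = λ {a} {b} xᵃ≈1 xᵇ≈1 →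
        trans (^-homo-* x a b) (trans (*-cong xᵃ≈1 xᵇ≈1) (*-identityˡ 1#))
    ; ∸-closed = λ {a} {b} xᵃ≈1 xᵃ⁺ᵇ≈1 → begin
        x ^ b              ≈⟨ *-identityˡ (x ^ b) ⟨
        1# * x ^ b         ≈⟨ *-congʳ xᵃ≈1 ⟨
        x ^ a * x ^ b      ≈⟨ ^-homo-* x a b ⟨
        x ^ (a ℕ.+ b)      ≈⟨ xᵃ⁺ᵇ≈1 ⟩
        1#                 ∎
    }

  InSub-^-isSubtractiveIdeal : ∀ b x → IsSubtractiveIdeal (λ k → InSub K (b ℕ.^ k) x)
  InSub-^-isSubtractiveIdeal b x = record
    { 0-closed = *-identityʳ x
    ; +-closed = λ {k} {l} fixₖ fixₗ → trans (shift {k} {l} fixₖ) fixₗ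
    ; ∸-closed = λ {k} {l} fixₖ fixₖ₊ₗ → trans (sym (shift {k} {l} fixₖ)) fixₖ₊ₗ
    }
    where
    shift : ∀ {k l} → InSub K (b ℕ.^ k) x → x ^ (b ℕ.^ (k ℕ.+ l)) ≈ x ^ (b ℕ.^ l)
    shift {k} {l} fixₖ = begin
      x ^ (b ℕ.^ (k ℕ.+ l))          ≡⟨ ≡.cong (x ^_) (ℕ.^-distribˡ-+-* b k l) ⟩
      x ^ (b ℕ.^ k ℕ.* b ℕ.^ l)      ≈⟨ ^-assocʳ x (b ℕ.^ k) (b ℕ.^ l) ⟨
      (x ^ (b ℕ.^ k)) ^ (b ℕ.^ l)    ≈⟨ ^-congˡ (b ℕ.^ l) fixₖ ⟩
      x ^ (b ℕ.^ l)                  ∎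

  AdditivePower : ℕ → Set (c ⊔ ℓ)
  AdditivePower Q = ∀ x y → (x + y) ^ Q ≈ x ^ Q + y ^ Q

  additivePower-* : ∀ {A B} → AdditivePower A → AdditivePower B → AdditivePower (A ℕ.* B)
  additivePower-* {A} {B} additiveA additiveB x y = begin
    (x + y) ^ (A ℕ.* B)             ≈⟨ ^-assocʳ (x + y) A B ⟨
    ((x + y) ^ A) ^ B               ≈⟨ ^-congˡ B (additiveA x y) ⟩
    (x ^ A + y ^ A) ^ B             ≈⟨ additiveB (x ^ A) (y ^ A) ⟩
    (x ^ A) ^ B + (y ^ A) ^ B       ≈⟨ +-cong (^-assocʳ x A B) (^-assocʳ y A B) ⟩
    x ^ (A ℕ.* B) + y ^ (A ℕ.* B)   ∎

  additivePower-^ : ∀ {Q} → AdditivePower Q → ∀ i → AdditivePower (Q ℕ.^ i)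
  additivePower-^ additive zero x y = trans (*-identityʳ (x + y)) (sym (+-cong (*-identityʳ x) (*-identityʳ y)))
  additivePower-^ {Q} additive (suc i) = additivePower-* {Q} {Q ℕ.^ i} additive (additivePower-^ {Q} additive i)

  frobenius : ∀ {p} → Prime p → p × 1# ≈ 0# → AdditivePower p
  frobenius {suc p} p-prime p≈0 x y = begin
    (x + y) ^ suc p                                       ≈⟨ Binomial.theorem (suc p) x y ⟩
    term zero + Sum.sum (λ k → term (suc k))              ≈⟨ +-congˡ (Sum.sum-init-last (λ k → term (suc k))) ⟩
    term zero + (Sum.sum middle + term (fromℕ (suc p)))   ≈⟨ +-congˡ (+-congʳ middle≈0) ⟩
    term zero + (0# + term (fromℕ (suc p)))               ≈⟨ +-cong first (trans (+-identityˡ _) last) ⟩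
    y ^ suc p + x ^ suc p                                 ≈⟨ +-comm _ _ ⟩
    x ^ suc p + y ^ suc p                                 ∎
    where
    open IsSubtractiveIdeal ×1≈0-isSubtractiveIdeal using (∣-closed)
    term = Binomial.binomialTerm x y (suc p)
    middle : Fin p → Carrier
    middle k = term (suc (inject₁ k))
    first : term zero ≈ y ^ suc p
    first = trans (+-identityʳ _) (*-identityˡ _)
    last : term (fromℕ (suc p)) ≈ x ^ suc p
    last rewrite Fin.toℕ-fromℕ p | nCn≡1 (suc p) | ℕ.n∸n≡0 p =
      trans (+-identityʳ _) (*-identityʳ _)
    middle≈0 : Sum.sum middle ≈ 0#
    middle≈0 = trans (Sum.sum-cong-≋ {p} λ k → ×1≈0⇒×≈0 (coefficient k) (∣-closed (p∣coefficient k) p≈0) _)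
                     (Sum.sum-replicate-zero p)
      where
      coefficient : Fin p → ℕ
      coefficient k = suc p C suc (toℕ (inject₁ k))
      p∣coefficient : ∀ k → suc p ∣ coefficient k
      p∣coefficient k = prime∣binomial p-prime (ℕ.s≤s ℕ.z≤n)
        (ℕ.s≤s (≡.subst (ℕ._< p) (≡.sym (Fin.toℕ-inject₁ k)) (Fin.toℕ<n k)))

  ^-^-comm : ∀ x A B → (x ^ A) ^ B ≈ (x ^ B) ^ A
  ^-^-comm x A B = begin
    (x ^ A) ^ B    ≈⟨ ^-assocʳ x A B ⟩
    x ^ (A ℕ.* B)  ≡⟨ ≡.cong (x ^_) (ℕ.*-comm A B) ⟩
    x ^ (B ℕ.* A)  ≈⟨ ^-assocʳ x B A ⟨
    (x ^ B) ^ A    ∎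

  x^Q≈x*x^[Q∸1] : ∀ Q .{{_ : ℕ.NonZero Q}} x → x ^ Q ≈ x * x ^ (Q ℕ.∸ 1)
  x^Q≈x*x^[Q∸1] Q x = ^-congʳ x (≡.sym (ℕ.suc-pred Q))

  module Subfield (Q : ℕ) where
    InSub-resp-≈ : ∀ {x y} → x ≈ y → InSub K Q x → InSub K Q y
    InSub-resp-≈ x≈y xᵠ≈x = trans (^-congˡ Q (sym x≈y)) (trans xᵠ≈x x≈y)

    InSub-1 : InSub K Q 1#
    InSub-1 = 1^n≈1 Q

    InSub-* : ∀ {x y} → InSub K Q x → InSub K Q y → InSub K Q (x * y)
    InSub-* {x} {y} xᵠ≈x yᵠ≈y = trans (^-distrib-* x y Q) (*-cong xᵠ≈x yᵠ≈y)

    InSub-^ : ∀ {x} → InSub K Q x → ∀ k → InSub K Q (x ^ k)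
    InSub-^ xᵠ≈x zero    = InSub-1
    InSub-^ xᵠ≈x (suc k) = InSub-* xᵠ≈x (InSub-^ xᵠ≈x k)

    InSub-iterate : ∀ {x} → InSub K Q x → ∀ i → InSub K (Q ℕ.^ i) x
    InSub-iterate {x} xᵠ≈x zero    = *-identityʳ x
    InSub-iterate {x} xᵠ≈x (suc i) = begin
      x ^ (Q ℕ.* Q ℕ.^ i)     ≈⟨ ^-assocʳ x Q (Q ℕ.^ i) ⟨
      (x ^ Q) ^ (Q ℕ.^ i)     ≈⟨ ^-congˡ (Q ℕ.^ i) xᵠ≈x ⟩
      x ^ (Q ℕ.^ i)           ≈⟨ InSub-iterate xᵠ≈x i ⟩
      x                       ∎

    InSub⇒x^[Q∸1]≈1 : ∀ {x} .{{_ : ℕ.NonZero Q}} → x ≉ 0# → InSub K Q x → x ^ (Q ℕ.∸ 1) ≈ 1#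
    InSub⇒x^[Q∸1]≈1 {x} x≉0 xᵠ≈x =
      *-cancelˡ-≉0 x≉0 (trans (sym (x^Q≈x*x^[Q∸1] Q x)) (trans xᵠ≈x (sym (*-identityʳ x))))

    x^Qⁱ≈x*uⁱ : ∀ {x u} → x ^ Q ≈ x * u → InSub K Q u → ∀ i → x ^ (Q ℕ.^ i) ≈ x * u ^ i
    x^Qⁱ≈x*uⁱ {x} {u} xᵠ≈xu uᵠ≈u zero    = refl
    x^Qⁱ≈x*uⁱ {x} {u} xᵠ≈xu uᵠ≈u (suc i) = begin
      x ^ (Q ℕ.* Q ℕ.^ i)             ≈⟨ ^-assocʳ x Q (Q ℕ.^ i) ⟨
      (x ^ Q) ^ (Q ℕ.^ i)             ≈⟨ ^-congˡ (Q ℕ.^ i) xᵠ≈xu ⟩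
      (x * u) ^ (Q ℕ.^ i)             ≈⟨ ^-distrib-* x u (Q ℕ.^ i) ⟩
      x ^ (Q ℕ.^ i) * u ^ (Q ℕ.^ i)   ≈⟨ *-cong (x^Qⁱ≈x*uⁱ xᵠ≈xu uᵠ≈u i) (InSub-iterate uᵠ≈u i) ⟩
      x * u ^ i * u                   ≈⟨ xy∙z≈x∙zy x (u ^ i) u ⟩
      x * u ^ suc i                   ∎
      where open import Algebra.Properties.CommutativeSemigroup *-commutativeSemigroup using (xy∙z≈x∙zy)

    InSub-inverse : ∀ {x y} → InSub K Q x → x ≉ 0# → x * y ≈ 1# → InSub K Q y
    InSub-inverse {x} {y} xᵠ≈x x≉0 xy≈1 = *-cancelˡ-≉0 x≉0 (begin
      x * y ^ Q       ≈⟨ *-congʳ xᵠ≈x ⟨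
      x ^ Q * y ^ Q   ≈⟨ ^-distrib-* x y Q ⟨
      (x * y) ^ Q     ≈⟨ InSub-resp-≈ (sym xy≈1) InSub-1 ⟩
      x * y           ∎)

    module _ (additive : AdditivePower Q) where

      InSub-0 : InSub K Q 0#
      InSub-0 = x+x≈x⇒x≈0 (0# ^ Q) (trans (sym (additive 0# 0#)) (^-congˡ Q (+-identityʳ 0#)))

      InSub-+ : ∀ {x y} → InSub K Q x → InSub K Q y → InSub K Q (x + y)
      InSub-+ {x} {y} xᵠ≈x yᵠ≈y = trans (additive x y) (+-cong xᵠ≈x yᵠ≈y)

      InSub-- : ∀ {x y} → InSub K Q x → InSub K Q y → InSub K Q (x - y)
      InSub-- {x} {y} xᵠ≈x yᵠ≈y =
        trans (additive x (- y)) (+-cong xᵠ≈x (trans -y^Q≈-y^Q (-‿cong yᵠ≈y)))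
        where
        -y^Q≈-y^Q : (- y) ^ Q ≈ - (y ^ Q)
        -y^Q≈-y^Q = +-inverseˡ-unique ((- y) ^ Q) (y ^ Q)
          (trans (sym (additive (- y) y)) (trans (^-congˡ Q (-‿inverseˡ y)) InSub-0))

      InSub-×1 : ∀ k → InSub K Q (k × 1#)
      InSub-×1 zero    = InSub-0
      InSub-×1 (suc k) = InSub-+ InSub-1 (InSub-×1 k)

      InSub-evalPoly : ∀ G → All (InSub K Q) G → ∀ {x} → InSub K Q x → InSub K Q (evalPoly K G x)
      InSub-evalPoly []      []            xᵠ≈x = InSub-0
      InSub-evalPoly (g ∷ G) (gᵠ≈g ∷ Gᵠ≈G) xᵠ≈x =
        InSub-+ gᵠ≈g (InSub-* xᵠ≈x (InSub-evalPoly G Gᵠ≈G xᵠ≈x))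

      ^-distrib-sumTo : ∀ n f → sumTo K n f ^ Q ≈ sumTo K n (λ i → f i ^ Q)
      ^-distrib-sumTo zero    f = InSub-0
      ^-distrib-sumTo (suc n) f = trans (additive _ _) (+-congʳ (^-distrib-sumTo n f))

module FiniteSetoid {c ℓ} (A : Setoid c ℓ) {N : ℕ} (size : Bijection (≡.setoid (Fin N)) A) where
  open import Data.Fin as Fin using (Fin)
  open import Data.Fin.Permutation using (permutation)
  open import Function.Bundles using (Inverse)
  open import Function.Definitions using (Congruent)
  open import Function.Properties.Bijection using (Bijection⇒Inverse)
  open import Algebra.Bundles using (CommutativeMonoid)
  open import Data.Product using (_×_)
  open Setoid A
  open Inverse (Bijection⇒Inverse size) public using (strictlyInverseˡ)
    renaming (to to enum; from to index)
  open Inverse (Bijection⇒Inverse size) using (from-cong; strictlyInverseʳ)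
  open import Relation.Binary.Reasoning.Setoid A

  index-injective : ∀ {x y} → index x ≡ index y → x ≈ y
  index-injective {x} {y} eq = begin
    x              ≈⟨ strictlyInverseˡ x ⟨
    enum (index x) ≡⟨ ≡.cong enum eq ⟩
    enum (index y) ≈⟨ strictlyInverseˡ y ⟩
    y              ∎

  enum-injective : ∀ {i j} → enum i ≈ enum j → i ≡ j
  enum-injective {i} {j} eq =
    ≡.trans (≡.sym (strictlyInverseʳ i)) (≡.trans (from-cong eq) (strictlyInverseʳ j))

  _≈?_ : ∀ x y → Dec (x ≈ y)
  x ≈? y with index x Fin.≟ index y
  ... | yes eq  = yes (index-injective eq)
  ... | no  neq = no (λ x≈y → neq (from-cong x≈y))

  injective⇒surjective : ∀ (f : Carrier → Carrier) → (∀ x y → f x ≈ f y → x ≈ y) →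
                         ∀ y → Σ Carrier λ x → f x ≈ y
  injective⇒surjective f f-injective y =
    let i , φi≡y = Fin-injective⇒surjective φ φ-injective (index y) in enum i , index-injective φi≡y
    where
    φ : Fin N → Fin N
    φ i = index (f (enum i))
    φ-injective : ∀ {i j} → φ i ≡ φ j → i ≡ j
    φ-injective eq = enum-injective (f-injective _ _ (index-injective eq))

  surjective⇒injective : ∀ (f : Carrier → Carrier) → Congruent _≈_ _≈_ f →
                         (∀ y → Σ Carrier λ x → f x ≈ y) → ∀ x y → f x ≈ f y → x ≈ y
  surjective⇒injective f f-cong f-surjective x y fx≈fy =
    index-injective (Fin-surjective⇒injective φ φ-surjective
      (≡.trans (φ∘index x) (≡.trans (from-cong fx≈fy) (≡.sym (φ∘index y)))))
    where
    φ : Fin N → Fin N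
    φ i = index (f (enum i))
    φ∘index : ∀ x → φ (index x) ≡ index (f x)
    φ∘index x = from-cong (f-cong (strictlyInverseˡ x))
    φ-surjective : ∀ j → ∃ λ i → φ i ≡ j
    φ-surjective j with x , fx≈j ← f-surjective (enum j) =
      index x , ≡.trans (φ∘index x) (≡.trans (from-cong fx≈j) (strictlyInverseʳ j))

  surjectiveOn⇒injectiveOn : ∀ (S : Carrier → Set ℓ) → (∀ x → Dec (S x)) →
                             (∀ {x y} → x ≈ y → S x → S y) →
                             ∀ (h : Carrier → Carrier) → Congruent _≈_ _≈_ h →
                             (∀ y → S y → Σ Carrier λ x → S x × h x ≈ y) →
                             ∀ x y → S x → S y → h x ≈ h y → x ≈ y
  surjectiveOn⇒injectiveOn S S? S-resp h h-cong h-surjective x y Sx Sy hx≈hy =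
    surjective⇒injective H H-cong H-surjective x y (trans (H-S Sx) (trans hx≈hy (sym (H-S Sy))))
    where
    H : Carrier → Carrier
    H x with S? x
    ... | yes _ = h x
    ... | no  _ = x
    H-S : ∀ {x} → S x → H x ≈ h x
    H-S {x} Sx with S? x
    ... | yes _  = refl
    ... | no ¬Sx = contradiction Sx ¬Sx
    H-¬S : ∀ {x} → ¬ S x → H x ≈ x
    H-¬S {x} ¬Sx with S? x
    ... | yes Sx = contradiction Sx ¬Sx
    ... | no  _  = refl
    H-cong : Congruent _≈_ _≈_ H
    H-cong {x} {y} x≈y with S? x
    ... | yes Sx  = trans (h-cong x≈y) (sym (H-S (S-resp x≈y Sx)))
    ... | no  ¬Sx = trans x≈y (sym (H-¬S (λ Sy → ¬Sx (S-resp (sym x≈y) Sy))))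
    H-surjective : ∀ y → Σ Carrier λ x → H x ≈ y
    H-surjective y with S? y
    ... | yes Sy  = let x , Sx , hx≈y = h-surjective y Sy in x , trans (H-S Sx) hx≈y
    ... | no  ¬Sy = y , H-¬S ¬Sy

  module _ {a b} (M : CommutativeMonoid a b) where
    open CommutativeMonoid M using () renaming (_≈_ to _≈ᴹ_; trans to transᴹ)
    open import Algebra.Properties.CommutativeMonoid.Sum M using (sum; sum-permute; sum-cong-≋)

    sum-reindex : ∀ (t t⁻¹ : Carrier → Carrier) → Congruent _≈_ _≈_ t → Congruent _≈_ _≈_ t⁻¹ →
                  (∀ x → t (t⁻¹ x) ≈ x) → (∀ x → t⁻¹ (t x) ≈ x) →
                  ∀ (f : Carrier → CommutativeMonoid.Carrier M) → Congruent _≈_ _≈ᴹ_ f →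
                  sum (λ i → f (enum i)) ≈ᴹ sum (λ i → f (t (enum i)))
    sum-reindex t t⁻¹ t-cong t⁻¹-cong t∘t⁻¹ t⁻¹∘t f f-cong =
      transᴹ (sum-permute _ π) (sum-cong-≋ (λ i → f-cong (strictlyInverseˡ (t (enum i)))))
      where
      π = permutation (λ i → index (t (enum i))) (λ i → index (t⁻¹ (enum i)))
        (λ j → ≡.trans (from-cong (trans (t-cong (strictlyInverseˡ _)) (t∘t⁻¹ _))) (strictlyInverseʳ j))
        (λ j → ≡.trans (from-cong (trans (t⁻¹-cong (strictlyInverseˡ _)) (t⁻¹∘t _))) (strictlyInverseʳ j))

module FiniteField {c ℓ} (K : Field c ℓ) {N : ℕ} (size : HasSize K N) where
  open import Data.Fin as Fin using (Fin; punchIn)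
  import Data.Fin.Properties as Fin
  open Field K hiding (zero)
  open FieldProperties K
  open FiniteSetoid setoid size public
  import Algebra.Properties.CommutativeMonoid.Sum +-commutativeMonoid as Sum
  import Algebra.Properties.CommutativeMonoid.Sum *-commutativeMonoid as Product
  open import Relation.Binary.Reasoning.Setoid setoid

  N×1≈0 : N × 1# ≈ 0#
  N×1≈0 = sym (+-cancelˡ ∑e 0# (N × 1#) (begin
    ∑e + 0#                        ≈⟨ +-identityʳ ∑e ⟩
    ∑e                             ≈⟨ sum-reindex +-commutativeMonoid (_+ 1#) (_- 1#) +-congʳ +-congʳ
                                       (//-rightDividesˡ 1#) (//-rightDividesʳ 1#) (λ x → x) (λ x≈y → x≈y) ⟩
    Sum.sum (λ i → enum i + 1#)   ≈⟨ Sum.∑-distrib-+ {N} enum (λ _ → 1#) ⟩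
    ∑e + Sum.sum {N} (λ _ → 1#)    ≈⟨ +-congˡ (Sum.sum-replicate N) ⟩
    ∑e + N × 1#                    ∎))
    where
    open import Algebra.Properties.Ring ring using (+-cancelˡ; //-rightDividesˡ; //-rightDividesʳ)
    ∑e = Sum.sum enum

  N≡b^k⇒b×1≈0 : ∀ b k → N ≡ b ℕ.^ k → b × 1# ≈ 0#
  N≡b^k⇒b×1≈0 b k N≡bᵏ with (b × 1#) ≈? 0#
  ... | yes b≈0 = b≈0
  ... | no  b≉0 = contradiction
    (trans (sym (×1-homo-^ b k)) (trans (reflexive (≡.cong (_× 1#) (≡.sym N≡bᵏ))) N×1≈0))
    (x^n≉0 b≉0 k)

  0↦1 : Carrier → Carrier
  0↦1 x with x ≈? 0#
  ... | yes _ = 1#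
  ... | no  _ = x

  0↦1-0 : ∀ {x} → x ≈ 0# → 0↦1 x ≈ 1#
  0↦1-0 {x} x≈0 with x ≈? 0#
  ... | yes _   = refl
  ... | no  x≉0 = contradiction x≈0 x≉0

  0↦1-≉0 : ∀ {x} → x ≉ 0# → 0↦1 x ≈ x
  0↦1-≉0 {x} x≉0 with x ≈? 0#
  ... | yes x≈0 = contradiction x≈0 x≉0
  ... | no  _   = refl

  0↦1-cong : ∀ {x y} → x ≈ y → 0↦1 x ≈ 0↦1 y
  0↦1-cong {x} {y} x≈y with x ≈? 0#
  ... | yes x≈0 = sym (0↦1-0 (trans (sym x≈y) x≈0))
  ... | no  x≉0 = trans x≈y (sym (0↦1-≉0 (λ y≈0 → x≉0 (trans x≈y y≈0))))

  -- Multiplication by x ≉ 0 permutes K and fixes 0; replacing 0 by 1 lets the product over all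
  -- of K be reindexed, and splitting off the factor at 0 leaves the product of the nonzero elements.
  x^[N-1]≈1 : ∀ {n} → N ≡ suc n → ∀ {x} → x ≉ 0# → x ^ n ≈ 1#
  x^[N-1]≈1 {n} ≡.refl {x} x≉0 = *-cancelʳ-≉0 (product≉0 nonzero nonzero≉0) (begin
    x ^ n * Π nonzero                    ≈⟨ *-congʳ (Product.sum-replicate n) ⟨
    Π {n} (λ _ → x) * Π nonzero          ≈⟨ Product.∑-distrib-+ (λ _ → x) nonzero ⟨
    Π (λ j → x * nonzero j)              ≈⟨ Product.sum-cong-≋ (λ j → 0↦1-≉0 (x*y≉0 x≉0 (nonzero≉0 j))) ⟨
    Π (λ j → 0↦1 (x * nonzero j))        ≈⟨ *-identityˡ _ ⟨
    1# * Π (λ j → 0↦1 (x * nonzero j))   ≈⟨ *-congʳ (0↦1-0 (trans (*-congˡ (strictlyInverseˡ 0#)) (zeroʳ x))) ⟨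
    0↦1 (x * enum i₀) * Π (λ j → 0↦1 (x * nonzero j))
                                         ≈⟨ Product.sum-remove (λ i → 0↦1 (x * enum i)) ⟨
    Π (λ i → 0↦1 (x * enum i))           ≈⟨ sum-reindex *-commutativeMonoid (x *_) (x⁻¹ *_) *-congˡ *-congˡ
                                               x[x⁻¹y]≈y x⁻¹[xy]≈y 0↦1 0↦1-cong ⟨
    Π (λ i → 0↦1 (enum i))               ≈⟨ Product.sum-remove (λ i → 0↦1 (enum i)) ⟩
    0↦1 (enum i₀) * Π (λ j → 0↦1 (nonzero j))
                                         ≈⟨ *-cong (0↦1-0 (strictlyInverseˡ 0#))
                                                   (Product.sum-cong-≋ (λ j → 0↦1-≉0 (nonzero≉0 j))) ⟩
    1# * Π nonzero                       ∎)
    where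
    Π = Product.sum
    i₀ = index 0#
    nonzero : Fin n → Carrier
    nonzero j = enum (punchIn i₀ j)
    nonzero≉0 : ∀ j → nonzero j ≉ 0#
    nonzero≉0 j eq = Fin.punchInᵢ≢i i₀ j (enum-injective (trans eq (sym (strictlyInverseˡ 0#))))
    x⁻¹ = proj₁ (inverse x x≉0)
    x*x⁻¹≈1 = proj₂ (inverse x x≉0)
    x[x⁻¹y]≈y : ∀ y → x * (x⁻¹ * y) ≈ y
    x[x⁻¹y]≈y y = trans (sym (*-assoc x x⁻¹ y)) (trans (*-congʳ x*x⁻¹≈1) (*-identityˡ y))
    x⁻¹[xy]≈y : ∀ y → x⁻¹ * (x * y) ≈ y
    x⁻¹[xy]≈y y =
      trans (sym (*-assoc x⁻¹ x y)) (trans (*-congʳ (trans (*-comm x⁻¹ x) x*x⁻¹≈1)) (*-identityˡ y))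

  fermat : ∀ x → x ^ N ≈ x
  fermat x with Fin-inhabited⇒≡suc (index 0#)
  ... | n , ≡.refl with x ≈? 0#
  ...   | yes x≈0 = trans (*-congʳ x≈0) (trans (zeroˡ _) (sym x≈0))
  ...   | no  x≉0 = trans (*-congˡ (x^[N-1]≈1 ≡.refl x≉0)) (*-identityʳ x)

module Trace {c ℓ} (K : Field c ℓ) (q n : ℕ) (additive : FieldProperties.AdditivePower K q) where
  open Field K hiding (zero)
  open FieldProperties K
  open Subfield q
  open import Relation.Binary.Reasoning.Setoid setoid

  T : Carrier → Carrier
  T = trace K q n

  trace-cong : ∀ {x y} → x ≈ y → T x ≈ T y
  trace-cong x≈y = sumTo-cong n (λ i → ^-congˡ (q ℕ.^ i) x≈y)

  trace-+ : ∀ x y → T (x + y) ≈ T x + T y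
  trace-+ x y = trans (sumTo-cong n (λ i → additivePower-^ {q} additive i x y)) (sumTo-distrib-+ n _ _)

  trace-*ʳ : ∀ x {c} → InSub K q c → T (x * c) ≈ T x * c
  trace-*ʳ x {c} cᵠ≈c = trans
    (sumTo-cong n (λ i → trans (^-distrib-* x c (q ℕ.^ i)) (*-congˡ (InSub-iterate cᵠ≈c i))))
    (sym (sumTo-distribʳ-* n _ c))

  trace-^ : ∀ Q → AdditivePower Q → ∀ x → T (x ^ Q) ≈ T x ^ Q
  trace-^ Q additiveQ x =
    sym (trans (Subfield.^-distrib-sumTo Q additiveQ n _) (sumTo-cong n (λ i → ^-^-comm x (q ℕ.^ i) Q)))

  trace-InSub : (∀ x → x ^ (q ℕ.^ n) ≈ x) → ∀ x → InSub K q (T x)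
  trace-InSub fermat x = +-cancelʳ x (T x ^ q) (T x) (begin
    T x ^ q + x                            ≈⟨ +-cong (^-distrib-sumTo additive n xᵠⁱ) (sym (*-identityʳ x)) ⟩
    sumTo K n (λ i → xᵠⁱ i ^ q) + xᵠⁱ 0    ≈⟨ +-congʳ (sumTo-cong n xᵠⁱ^q≈xᵠⁱ⁺¹) ⟩
    sumTo K n (λ i → xᵠⁱ (suc i)) + xᵠⁱ 0  ≈⟨ sumTo-rotate n xᵠⁱ ⟩
    T x + xᵠⁱ n                            ≈⟨ +-congˡ (fermat x) ⟩
    T x + x                                ∎)
    where
    xᵠⁱ : ℕ → Carrier
    xᵠⁱ i = x ^ (q ℕ.^ i)
    xᵠⁱ^q≈xᵠⁱ⁺¹ : ∀ i → xᵠⁱ i ^ q ≈ xᵠⁱ (suc i)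
    xᵠⁱ^q≈xᵠⁱ⁺¹ i = trans (^-assocʳ x (q ℕ.^ i) q) (^-congʳ x (ℕ.*-comm (q ℕ.^ i) q))

  trace-of-InSub : ∀ {z} → InSub K q z → T z ≈ (n × 1#) * z
  trace-of-InSub {z} zᵠ≈z = trans (sumTo-cong n (InSub-iterate zᵠ≈z)) (sumTo-const n z)

  trace-surjective : n × 1# ≉ 0# → ∀ s → InSub K q s → Σ Carrier λ x → T x ≈ s
  trace-surjective n≉0 s sᵠ≈s = s * n⁻¹ , (begin
    T (s * n⁻¹)            ≈⟨ trace-of-InSub (InSub-* sᵠ≈s n⁻¹ᵠ≈n⁻¹) ⟩
    (n × 1#) * (s * n⁻¹)   ≈⟨ x∙yz≈y∙xz (n × 1#) s n⁻¹ ⟩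
    s * ((n × 1#) * n⁻¹)   ≈⟨ *-congˡ (proj₂ (inverse (n × 1#) n≉0)) ⟩
    s * 1#                 ≈⟨ *-identityʳ s ⟩
    s                      ∎)
    where
    open import Algebra.Properties.CommutativeSemigroup *-commutativeSemigroup using (x∙yz≈y∙xz)
    n⁻¹ = proj₁ (inverse (n × 1#) n≉0)
    n⁻¹ᵠ≈n⁻¹ : InSub K q n⁻¹
    n⁻¹ᵠ≈n⁻¹ = InSub-inverse (InSub-×1 additive n) n≉0 (proj₂ (inverse (n × 1#) n≉0))

module PermutationCriterion
  {c₀ ℓ} (K : Field c₀ ℓ) (p m n r : ℕ) (p-prime : Prime p) (size : HasSize K ((p ℕ.^ m) ℕ.^ n))
  (gcd-eq : gcd m r ≡ gcd (m ℕ.* n) r) (p∤n : ¬ p ∣ n) (coprime : gcd n (p ℕ.^ gcd m r ℕ.∸ 1) ≡ 1)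
  {a : Field.Carrier K} (aᵠ≈a : InSub K (p ℕ.^ m) a) (a≉0 : ¬ Field._≈_ K a (Field.0# K))
  where

  open import Function.Definitions using (Congruent)
  open import Function.Properties.Equivalence using () renaming (trans to ⇔-trans)
  open import Data.Unit.Polymorphic using (tt)
  open import Data.List using (List)
  open Field K hiding (zero)
  open FieldProperties K hiding (_×_)
  open FiniteField K size
  open import Relation.Binary.Reasoning.Setoid setoid

  q P : ℕ
  q = p ℕ.^ m
  P = p ℕ.^ r

  instance
    _ = prime⇒nonZero p-prime
    _ = ℕ.m^n≢0 p m
    _ = ℕ.m^n≢0 p r

  Fq : Carrier → Set ℓ
  Fq = InSub K q

  -- Opened locally: this _×_ would clash with the product type used in Reduction.
  module _ where
    open FieldProperties K using (_×_)
    open IsSubtractiveIdeal ×1≈0-isSubtractiveIdeal using (gcd-closed)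

    p×1≈0 : p × 1# ≈ 0#
    p×1≈0 = N≡b^k⇒b×1≈0 p (m ℕ.* n) (ℕ.^-*-assoc p m n)

    n×1≉0 : n × 1# ≉ 0#
    n×1≉0 n×1≈0 = 0≉1 (sym (begin
      1#             ≈⟨ +-identityʳ 1# ⟨
      1 × 1#         ≡⟨ ≡.cong (_× 1#) (prime∤⇒gcd≡1 p-prime p∤n) ⟨
      gcd n p × 1#   ≈⟨ gcd-closed n p n×1≈0 p×1≈0 ⟩
      0#             ∎))

  additive-q : AdditivePower q
  additive-q = additivePower-^ {p} (frobenius p-prime p×1≈0) m

  additive-P : AdditivePower P
  additive-P = additivePower-^ {p} (frobenius p-prime p×1≈0) r

  open Subfield q
  open Trace K q n additive-q

  L : Carrier → Carrier → Carrier
  L c x = a * x ^ P + x * c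

  L-cong : ∀ c {x y} → x ≈ y → L c x ≈ L c y
  L-cong c x≈y = +-cong (*-congˡ (^-congˡ P x≈y)) (*-congʳ x≈y)

  L-+ : ∀ c x y → L c (x + y) ≈ L c x + L c y
  L-+ c x y = begin
    a * (x + y) ^ P + (x + y) * c                ≈⟨ +-cong (*-congˡ (additive-P x y)) (distribʳ c x y) ⟩
    a * (x ^ P + y ^ P) + (x * c + y * c)        ≈⟨ +-congʳ (distribˡ a (x ^ P) (y ^ P)) ⟩
    a * x ^ P + a * y ^ P + (x * c + y * c)      ≈⟨ interchange (a * x ^ P) (a * y ^ P) (x * c) (y * c) ⟩
    a * x ^ P + x * c + (a * y ^ P + y * c)      ∎
    where open import Algebra.Properties.CommutativeSemigroup +-commutativeSemigroup using (interchange)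

  L-^q : ∀ {c} → Fq c → ∀ x → L c x ^ q ≈ L c (x ^ q)
  L-^q {c} cᵠ≈c x = begin
    (a * x ^ P + x * c) ^ q               ≈⟨ additive-q (a * x ^ P) (x * c) ⟩
    (a * x ^ P) ^ q + (x * c) ^ q         ≈⟨ +-cong (^-distrib-* a (x ^ P) q) (^-distrib-* x c q) ⟩
    a ^ q * (x ^ P) ^ q + x ^ q * c ^ q   ≈⟨ +-cong (*-cong aᵠ≈a (^-^-comm x P q)) (*-congˡ cᵠ≈c) ⟩
    a * (x ^ q) ^ P + x ^ q * c           ∎

  -- L c (z ^ q) ≈ (L c z) ^ q ≈ 0 as a, c ∈ F_q; writing z ^ q = z u and subtracting u · L c z ≈ 0
  -- leaves a z^P (u^P − u) ≈ 0.
  L-root⇒ratio-fixed : ∀ {c z} → Fq c → z ≉ 0# → L c z ≈ 0# → InSub K P (z ^ (q ℕ.∸ 1))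
  L-root⇒ratio-fixed {c} {z} cᵠ≈c z≉0 Lz≈0 =
    *-cancelˡ-≉0 (x*y≉0 a≉0 (x^n≉0 z≉0 P)) (+-cancelʳ (z * c * u) _ _ (begin
      a * z ^ P * u ^ P + z * c * u   ≈⟨ +-cong (*-assoc a (z ^ P) (u ^ P)) (xy∙z≈xz∙y z c u) ⟩
      a * (z ^ P * u ^ P) + z * u * c ≈⟨ +-congʳ (*-congˡ (^-distrib-* z u P)) ⟨
      L c (z * u)                     ≈⟨ L-cong c (x^Q≈x*x^[Q∸1] q z) ⟨
      L c (z ^ q)                     ≈⟨ L-^q cᵠ≈c z ⟨
      L c z ^ q                       ≈⟨ ^-congˡ q Lz≈0 ⟩
      0# ^ q                          ≈⟨ InSub-0 additive-q ⟩
      0#                              ≈⟨ zeroˡ u ⟨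
      0# * u                          ≈⟨ *-congʳ Lz≈0 ⟨
      L c z * u                       ≈⟨ distribʳ u (a * z ^ P) (z * c) ⟩
      a * z ^ P * u + z * c * u       ∎))
    where
    open import Algebra.Properties.CommutativeSemigroup *-commutativeSemigroup using (xy∙z≈xz∙y)
    u = z ^ (q ℕ.∸ 1)

  fixed-by-p^gcd : ∀ {u} → InSub K P u → InSub K (p ℕ.^ gcd m r) u
  fixed-by-p^gcd {u} uᴾ≈u = ≡.subst (λ k → InSub K (p ℕ.^ k) u) (≡.sym gcd-eq)
    (gcd-closed (m ℕ.* n) r (trans (^-congʳ u (≡.sym (ℕ.^-*-assoc p m n))) (fermat u)) uᴾ≈u)
    where open IsSubtractiveIdeal (InSub-^-isSubtractiveIdeal p u) using (gcd-closed)

  L-root⇒InSub : ∀ {c z} → Fq c → z ≉ 0# → L c z ≈ 0# → Fq z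
  L-root⇒InSub {c} {z} cᵠ≈c z≉0 Lz≈0 = begin
    z ^ q    ≈⟨ x^Q≈x*x^[Q∸1] q z ⟩
    z * u    ≈⟨ *-congˡ u≈1 ⟩
    z * 1#   ≈⟨ *-identityʳ z ⟩
    z        ∎
    where
    u = z ^ (q ℕ.∸ 1)
    uᵖᵈ≈u : InSub K (p ℕ.^ gcd m r) u
    uᵖᵈ≈u = fixed-by-p^gcd (L-root⇒ratio-fixed cᵠ≈c z≉0 Lz≈0)
    uᵠ≈u : Fq u
    uᵠ≈u = IsSubtractiveIdeal.∣-closed (InSub-^-isSubtractiveIdeal p u) (gcd[m,n]∣m m r) uᵖᵈ≈u
    uⁿ≈1 : u ^ n ≈ 1#
    uⁿ≈1 = *-cancelˡ-≉0 z≉0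
      (trans (sym (x^Qⁱ≈x*uⁱ (x^Q≈x*x^[Q∸1] q z) uᵠ≈u n)) (trans (fermat z) (sym (*-identityʳ z))))
    u^[pᵈ∸1]≈1 : u ^ (p ℕ.^ gcd m r ℕ.∸ 1) ≈ 1#
    u^[pᵈ∸1]≈1 = Subfield.InSub⇒x^[Q∸1]≈1 (p ℕ.^ gcd m r) {{ℕ.m^n≢0 p (gcd m r)}}
                   (x^n≉0 z≉0 (q ℕ.∸ 1)) uᵖᵈ≈u
    u≈1 : u ≈ 1#
    u≈1 = trans (sym (*-identityʳ u)) (≡.subst (λ k → u ^ k ≈ 1#) coprime
      (IsSubtractiveIdeal.gcd-closed (^≈1-isSubtractiveIdeal u) n _ uⁿ≈1 u^[pᵈ∸1]≈1))

  kernel-trivial : ∀ {c z} → Fq c → T z ≈ 0# → L c z ≈ 0# → z ≈ 0#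
  kernel-trivial {c} {z} cᵠ≈c Tz≈0 Lz≈0 with z ≈? 0#
  ... | yes z≈0 = z≈0
  ... | no  z≉0 = contradiction (trans (sym (trace-of-InSub (L-root⇒InSub cᵠ≈c z≉0 Lz≈0))) Tz≈0)
                                (x*y≉0 n×1≉0 z≉0)

  module Reduction
    (g : Carrier → Carrier) (g-cong : Congruent _≈_ _≈_ g) (g-InSub : ∀ {s} → Fq s → Fq (g s))
    where
    open import Data.Product using (_×_)
    open import Algebra.Properties.Ring ring using (//-rightDividesˡ)

    coefficient : Carrier → Carrier
    coefficient s = g s - a * s ^ (P ℕ.∸ 1)

    F : Carrier → Carrier
    F x = L (coefficient (T x)) x

    h : Carrier → Carrier
    h s = s * g s

    coefficient-cong : ∀ {s t} → s ≈ t → coefficient s ≈ coefficient t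
    coefficient-cong s≈t = +-cong (g-cong s≈t) (-‿cong (*-congˡ (^-congˡ (P ℕ.∸ 1) s≈t)))

    coefficient-InSub : ∀ {s} → Fq s → Fq (coefficient s)
    coefficient-InSub sᵠ≈s = InSub-- additive-q (g-InSub sᵠ≈s) (InSub-* aᵠ≈a (InSub-^ sᵠ≈s (P ℕ.∸ 1)))

    T-InSub : ∀ x → Fq (T x)
    T-InSub = trace-InSub fermat

    trace-F : ∀ x → T (F x) ≈ h (T x)
    trace-F x = begin
      T (a * x ^ P + x * c)                ≈⟨ trace-+ (a * x ^ P) (x * c) ⟩
      T (a * x ^ P) + T (x * c)            ≈⟨ +-cong (trace-cong (*-comm a (x ^ P)))
                                                     (trace-*ʳ x (coefficient-InSub (T-InSub x))) ⟩
      T (x ^ P * a) + s * c                ≈⟨ +-congʳ (trace-*ʳ (x ^ P) aᵠ≈a) ⟩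
      T (x ^ P) * a + s * c                ≈⟨ +-congʳ (*-congʳ (trace-^ P additive-P x)) ⟩
      s ^ P * a + s * c                    ≈⟨ +-congʳ (*-comm (s ^ P) a) ⟩
      a * s ^ P + s * c                    ≈⟨ +-congʳ (*-congˡ (x^Q≈x*x^[Q∸1] P s)) ⟩
      a * (s * s ^ (P ℕ.∸ 1)) + s * c      ≈⟨ +-congʳ (x∙yz≈y∙xz a s (s ^ (P ℕ.∸ 1))) ⟩
      s * (a * s ^ (P ℕ.∸ 1)) + s * c      ≈⟨ distribˡ s (a * s ^ (P ℕ.∸ 1)) c ⟨
      s * (a * s ^ (P ℕ.∸ 1) + c)          ≈⟨ *-congˡ (+-comm _ c) ⟩
      s * (c + a * s ^ (P ℕ.∸ 1))          ≈⟨ *-congˡ (//-rightDividesˡ (a * s ^ (P ℕ.∸ 1)) (g s)) ⟩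
      s * g s                              ∎
      where
      open import Algebra.Properties.CommutativeSemigroup *-commutativeSemigroup using (x∙yz≈y∙xz)
      s = T x
      c = coefficient s

    F-injective : (∀ s t → Fq s → Fq t → h s ≈ h t → s ≈ t) → ∀ x y → F x ≈ F y → x ≈ y
    F-injective h-injective x y Fx≈Fy = begin
      x          ≈⟨ x≈z+y ⟩
      z + y      ≈⟨ +-congʳ (kernel-trivial (coefficient-InSub (T-InSub x)) Tz≈0 Lz≈0) ⟩
      0# + y     ≈⟨ +-identityˡ y ⟩
      y          ∎
      where
      Tx≈Ty : T x ≈ T y
      Tx≈Ty = h-injective (T x) (T y) (T-InSub x) (T-InSub y)
        (trans (sym (trace-F x)) (trans (trace-cong Fx≈Fy) (trace-F y)))
      c = coefficient (T x)
      z = x - y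
      x≈z+y : x ≈ z + y
      x≈z+y = sym (//-rightDividesˡ y x)
      Lz≈0 : L c z ≈ 0#
      Lz≈0 = +-cancelʳ (L c y) (L c z) 0# (begin
        L c z + L c y                 ≈⟨ L-+ c z y ⟨
        L c (z + y)                   ≈⟨ L-cong c x≈z+y ⟨
        F x                           ≈⟨ Fx≈Fy ⟩
        F y                           ≈⟨ +-congˡ (*-congˡ (coefficient-cong (sym Tx≈Ty))) ⟩
        L c y                         ≈⟨ +-identityˡ (L c y) ⟨
        0# + L c y                    ∎)
      Tz≈0 : T z ≈ 0#
      Tz≈0 = +-cancelʳ (T y) (T z) 0# (begin
        T z + T y                     ≈⟨ trace-+ z y ⟨
        T (z + y)                     ≈⟨ trace-cong x≈z+y ⟨
        T x                           ≈⟨ Tx≈Ty ⟩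
        T y                           ≈⟨ +-identityˡ (T y) ⟨
        0# + T y                      ∎)

    h-surjective : (∀ y → Σ Carrier λ x → F x ≈ y) → ∀ s → Fq s → Σ Carrier λ t → Fq t × h t ≈ s
    h-surjective F-surjective s sᵠ≈s =
      let y , Ty≈s  = trace-surjective n×1≉0 s sᵠ≈s
          x , Fx≈y  = F-surjective y
      in T x , T-InSub x , trans (sym (trace-F x)) (trans (trace-cong Fx≈y) Ty≈s)

    F-permutes⇔h-permutes : PermutesOn K (Whole K) F ⇔ PermutesOn K Fq h
    F-permutes⇔h-permutes = mk⇔
      (λ (_ , _ , F-onto) →
        let h-onto = h-surjective (λ y → let x , _ , Fx≈y = F-onto y tt in x , Fx≈y) in
        (λ s sᵠ≈s → InSub-* sᵠ≈s (g-InSub sᵠ≈s)) ,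
        surjectiveOn⇒injectiveOn Fq (λ s → (s ^ q) ≈? s) InSub-resp-≈ h h-cong h-onto ,
        h-onto)
      (λ (_ , h-injective , _) →
        (λ _ _ → tt) ,
        (λ x y _ _ → F-injective h-injective x y) ,
        (λ y _ → let x , Fx≈y = injective⇒surjective F (F-injective h-injective) y in x , tt , Fx≈y))
      where
      h-cong : Congruent _≈_ _≈_ h
      h-cong s≈t = *-cong s≈t (g-cong s≈t)

  module WithPolynomial (G : List Carrier) (Gᵠ≈G : PolyOver K q G) where
    G-InSub : ∀ {s} → Fq s → Fq (evalPoly K G s)
    G-InSub = InSub-evalPoly additive-q G Gᵠ≈G

    module ForG   = Reduction (evalPoly K G) (evalPoly-cong G) G-InSub
    module ForG+1 = Reduction (λ s → evalPoly K G s + 1#) (λ s≈t → +-congʳ (evalPoly-cong G s≈t))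
                              (λ sᵠ≈s → InSub-+ additive-q (G-InSub sᵠ≈s) InSub-1)

    F[G]+id≈F[G+1] : ∀ x → ForG.F x + x ≈ ForG+1.F x
    F[G]+id≈F[G+1] x = begin
      a * x ^ P + x * (g - A) + x          ≈⟨ +-assoc (a * x ^ P) (x * (g - A)) x ⟩
      a * x ^ P + (x * (g - A) + x)        ≈⟨ +-congˡ (+-congˡ (*-identityʳ x)) ⟨
      a * x ^ P + (x * (g - A) + x * 1#)   ≈⟨ +-congˡ (distribˡ x (g - A) 1#) ⟨
      a * x ^ P + x * (g - A + 1#)         ≈⟨ +-congˡ (*-congˡ (xy∙z≈xz∙y g (- A) 1#)) ⟩
      a * x ^ P + x * (g + 1# - A)         ∎
      where
      open import Algebra.Properties.CommutativeSemigroup +-commutativeSemigroup using (xy∙z≈xz∙y)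
      g = evalPoly K G (T x)
      A = a * T x ^ (P ℕ.∸ 1)

    h[G+1]≈h[G]+id : ∀ s → ForG+1.h s ≈ ForG.h s + s
    h[G+1]≈h[G]+id s = trans (distribˡ s (evalPoly K G s) 1#) (+-congˡ (*-identityʳ s))

    F+id-permutes⇔h+id-permutes :
      PermutesOn K (Whole K) (λ x → ForG.F x + x) ⇔ PermutesOn K Fq (λ s → ForG.h s + s)
    F+id-permutes⇔h+id-permutes =
      ⇔-trans (PermutesOn-cong (λ _ x∈K → x∈K) F[G]+id≈F[G+1])
      (⇔-trans ForG+1.F-permutes⇔h-permutes
               (PermutesOn-cong InSub-resp-≈ h[G+1]≈h[G]+id))

open import Data.Nat using (_*_; _∸_; _^_; _≥_)
open import Data.List using (List)
open import Data.Product.Function.NonDependent.Propositional using (_×-⇔_)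

theorem3p4 : ∀ {c ℓ} (p m n r : ℕ) → Prime p → m ≥ 1 → n ≥ 1 → r ≥ 1 →
    gcd m r ≡ gcd (m * n) r → ¬ (p ∣ n) → gcd n (p ^ gcd m r ∸ 1) ≡ 1 →
    (K : Field c ℓ) → HasSize K ((p ^ m) ^ n) →
    (G : List (Field.Carrier K)) → PolyOver K (p ^ m) G →
    (a : Field.Carrier K) → InSub K (p ^ m) a → ¬ (Field._≈_ K a (Field.0# K)) →
    CompletePermOn K (Whole K)
      (λ x → Field._+_ K (Field._*_ K a (Field._^_ K x (p ^ r)))
               (Field._*_ K x
                 (Field._-_ K (evalPoly K G (trace K (p ^ m) n x))
                   (Field._*_ K a (Field._^_ K (trace K (p ^ m) n x) (p ^ r ∸ 1))))))
    ⇔ CompletePermOn K (InSub K (p ^ m)) (λ x → Field._*_ K x (evalPoly K G x))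
theorem3p4 p m n r p-prime _ _ _ gcd-eq p∤n coprime K size G Gᵠ≈G a aᵠ≈a a≉0 =
  ForG.F-permutes⇔h-permutes ×-⇔ F+id-permutes⇔h+id-permutes
  where
  open PermutationCriterion K p m n r p-prime size gcd-eq p∤n coprime aᵠ≈a a≉0
  open WithPolynomial G Gᵠ≈G
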